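{- Let $G$ be a connected $2$-edge-colored multigraph on $n$ vertices whose edges are colored red or blue. Suppose $G$ contains a proper cycle $C$ with $|C|\le n-2$ vertices, and suppose there is a red edge $xy$ of $G$ with $x,y\notin V(C)$. If $d^b_C(x)+d^b_C(y)>|C|$, then $G$ contains a proper cycle of length $|C|+2$ that contains the edge $xy$.
   Context: A $c$-edge-colored multigraph has each edge colored with one color from $\{1,\dots,c\}$, and no two edges joining the same pair of vertices have the same color (there are no loops). Throughout, multigraphs are assumed connected. For a set $H$ of vertices and a vertex $x$, $d^i_H(x)$ denotes the number of vertices of $H$ joined to $x$ by an edge of color $i$; $d^b$ refers to the color blue. A subgraph is proper (properly colored) if any two adjacent edges in it have different colors. A cycle is a sequence of distinct vertices $v_1\dots v_k$ with $v_iv_{i+1}$ edges and $v_kv_1$ an edge; its length $|C|$ is its number of vertices. -}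

module Defs where

open import Data.Nat using (ℕ; zero; suc; _+_; _≤_)
open import Data.Nat.DivMod using (_mod_)
open import Data.Fin using (Fin; toℕ)
open import Data.Bool using (Bool; true; false; if_then_else_)
open import Data.Product using (Σ; ∃; _×_; _,_)
open import Data.Sum using (_⊎_)
open import Function.Definitions using (Injective)
open import Relation.Binary.PropositionalEquality using (_≡_)
open import Relation.Nullary using (¬_)

data Color : Set where
  red blue : Color

-- A 2-edge-coloured multigraph on vertex set Fin n:
-- E u v c ≡ true  iff there is an edge of colour c joining u and v.
-- (At most one edge of each colour between a pair is automatic.)
record Multigraph2 (n : ℕ) : Set where
  field
    E     : Fin n → Fin n → Color → Bool
    sym   : ∀ u v c → E u v c ≡ E v u c
    loopless : ∀ u c → E u u c ≡ false
open Multigraph2 public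

Adj : ∀ {n} → Multigraph2 n → Fin n → Fin n → Set
Adj G u v = ∃ λ c → E G u v c ≡ true

data Reach {n} (G : Multigraph2 n) : Fin n → Fin n → Set where
  here : ∀ {u} → Reach G u u
  step : ∀ {u v w} → Adj G u v → Reach G v w → Reach G u w

Connected : ∀ {n} → Multigraph2 n → Set
Connected G = ∀ u v → Reach G u v

next : ∀ {k} → Fin k → Fin k
next {suc m} i = suc (toℕ i) mod (suc m)

-- A cycle v_0 … v_{k-1} (k ≥ 2) of distinct vertices, together with the
-- colour col i of the edge used between v_i and v_{i+1 mod k}.
record Cycle {n} (G : Multigraph2 n) (k : ℕ) : Set where
  field
    two≤k   : 2 ≤ k
    vtx     : Fin k → Fin n
    distinct : Injective _≡_ _≡_ vtx
    col     : Fin k → Color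
    edge    : ∀ i → E G (vtx i) (vtx (next i)) (col i) ≡ true
open Cycle public

Proper : ∀ {n} {G : Multigraph2 n} {k} → Cycle G k → Set
Proper C = ∀ i → ¬ (col C i ≡ col C (next i))

OnCycle : ∀ {n} {G : Multigraph2 n} {k} → Cycle G k → Fin n → Set
OnCycle C x = ∃ λ i → vtx C i ≡ x

UsesEdge : ∀ {n} {G : Multigraph2 n} {k} → Cycle G k → Fin n → Fin n → Color → Set
UsesEdge C x y c = ∃ λ i → col C i ≡ c ×
  ((vtx C i ≡ x × vtx C (next i) ≡ y) ⊎ (vtx C i ≡ y × vtx C (next i) ≡ x))

countFin : ∀ k → (Fin k → Bool) → ℕ
countFin zero p = 0
countFin (suc k) p = (if p Fin.zero then 1 else 0) + countFin k (λ i → p (Fin.suc i))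

degC : ∀ {n} {G : Multigraph2 n} {k} → Color → Cycle G k → Fin n → ℕ
degC {G = G} {k} c C x = countFin k (λ i → E G x (vtx C i) c)

-- A blue edge v_i v_{i+1} of the proper cycle C with x v_i and y v_{i+1} blue (or the same
-- with x, y exchanged) can be replaced by the path v_i x y v_{i+1}, which keeps the colouring
-- proper since xy is red and the neighbouring edges of the cycle are red. If no blue edge
-- admits this, each blue edge sees at most two of the four blue adjacencies from {x, y} to its
-- ends; as C alternates, its blue edges partition its vertices, so the blue degrees of x and y
-- into C add up to at most |C|.
module Submission where

open import Data.Bool using (Bool; true; false; if_then_else_)
import Data.Bool.Properties as Bool
open import Data.Empty using (⊥-elim)
open import Data.Fin using (Fin; zero; suc; toℕ; fromℕ; inject₁)
open import Data.Fin.Properties using (toℕ-injective; toℕ-fromℕ<; toℕ<n; toℕ-inject₁; toℕ-fromℕ; any?)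
open import Data.Nat using (ℕ; zero; suc; _+_; _*_; _≤_; _<_; _∸_; z≤n; s≤s; NonZero; _%_)
open import Data.Nat.DivMod using (_mod_; %-distribˡ-+; m%n%n≡m%n; [m+kn]%n≡m%n; [m+n]%n≡m%n; m<n⇒m%n≡m; n%n≡0)
open import Data.Nat.Properties
open import Algebra.Properties.CommutativeMonoid.Sum +-0-commutativeMonoid
  using (sum; sum-cong-≗; ∑-distrib-+; sum-init-last)
open import Data.Nat.Tactic.RingSolver using (solve-∀)
open import Data.Product using (Σ; ∃; _×_; _,_)
open import Data.Sum using (_⊎_; inj₁; inj₂)
open import Function using (_∘_)
open import Relation.Binary.PropositionalEquality
open import Relation.Nullary using (¬_; Dec; yes; no)
open import Relation.Nullary.Decidable using (_×-dec_; _⊎-dec_)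

open import Defs renaming (sym to E-sym)

open ≡-Reasoning

[m%d+n]%d≡[m+n]%d : ∀ m n d .{{_ : NonZero d}} → (m % d + n) % d ≡ (m + n) % d
[m%d+n]%d≡[m+n]%d m n d = begin
  (m % d + n) % d           ≡⟨ %-distribˡ-+ (m % d) n d ⟩
  (m % d % d + n % d) % d   ≡⟨ cong (λ r → (r + n % d) % d) (m%n%n≡m%n m d) ⟩
  (m % d + n % d) % d       ≡⟨ %-distribˡ-+ m n d ⟨
  (m + n) % d               ∎

toℕ-next : ∀ {m} (j : Fin (suc m)) → toℕ (next j) ≡ suc (toℕ j) % suc m
toℕ-next j = toℕ-fromℕ< _

next-inject₁ : ∀ {m} (i : Fin m) → next (inject₁ i) ≡ suc i
next-inject₁ {m} i = toℕ-injective (begin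
  toℕ (next (inject₁ i))       ≡⟨ toℕ-next (inject₁ i) ⟩
  suc (toℕ (inject₁ i)) % suc m ≡⟨ cong (λ r → suc r % suc m) (toℕ-inject₁ i) ⟩
  suc (toℕ i) % suc m           ≡⟨ m<n⇒m%n≡m (s≤s (toℕ<n i)) ⟩
  suc (toℕ i)                   ∎)

next-fromℕ : ∀ m → next (fromℕ m) ≡ zero
next-fromℕ m = toℕ-injective (begin
  toℕ (next (fromℕ m))       ≡⟨ toℕ-next (fromℕ m) ⟩
  suc (toℕ (fromℕ m)) % suc m ≡⟨ cong (λ r → suc r % suc m) (toℕ-fromℕ m) ⟩
  suc m % suc m               ≡⟨ n%n≡0 (suc m) ⟩
  0                           ∎)

fromℕ-or-inject₁ : ∀ {m} (u : Fin (suc m)) → u ≡ fromℕ m ⊎ ∃ λ v → u ≡ inject₁ v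
fromℕ-or-inject₁ {zero}  zero    = inj₁ refl
fromℕ-or-inject₁ {suc m} zero    = inj₂ (zero , refl)
fromℕ-or-inject₁ {suc m} (suc u) with fromℕ-or-inject₁ u
... | inj₁ u≡last   = inj₁ (cong suc u≡last)
... | inj₂ (v , u≡v) = inj₂ (suc v , cong suc u≡v)

rotate : ∀ {m} → ℕ → Fin (suc m) → Fin (suc m)
rotate s j = (toℕ j + s) mod _

module _ {m : ℕ} where

  private K = suc m

  toℕ-rotate : ∀ s (j : Fin K) → toℕ (rotate s j) ≡ (toℕ j + s) % K
  toℕ-rotate s j = toℕ-fromℕ< _

  rotate-rotate : ∀ s t (j : Fin K) → rotate t (rotate s j) ≡ rotate (s + t) j
  rotate-rotate s t j = toℕ-injective (begin
    toℕ (rotate t (rotate s j))  ≡⟨ toℕ-rotate t (rotate s j) ⟩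
    (toℕ (rotate s j) + t) % K   ≡⟨ cong (λ r → (r + t) % K) (toℕ-rotate s j) ⟩
    ((toℕ j + s) % K + t) % K    ≡⟨ [m%d+n]%d≡[m+n]%d (toℕ j + s) t K ⟩
    (toℕ j + s + t) % K          ≡⟨ cong (_% K) (+-assoc (toℕ j) s t) ⟩
    (toℕ j + (s + t)) % K        ≡⟨ toℕ-rotate (s + t) j ⟨
    toℕ (rotate (s + t) j)       ∎)

  rotate-multiple : ∀ q (j : Fin K) → rotate (q * K) j ≡ j
  rotate-multiple q j = toℕ-injective (begin
    toℕ (rotate (q * K) j) ≡⟨ toℕ-rotate (q * K) j ⟩
    (toℕ j + q * K) % K    ≡⟨ [m+kn]%n≡m%n (toℕ j) q K ⟩
    toℕ j % K              ≡⟨ m<n⇒m%n≡m (toℕ<n j) ⟩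
    toℕ j                  ∎)

  -- rotate (s * m) undoes rotate s, since s + s * m is a multiple of K.
  rotate-injective : ∀ s {i j : Fin K} → rotate s i ≡ rotate s j → i ≡ j
  rotate-injective s {i} {j} eq = begin
    i                             ≡⟨ undo i ⟨
    rotate (s * m) (rotate s i)   ≡⟨ cong (rotate (s * m)) eq ⟩
    rotate (s * m) (rotate s j)   ≡⟨ undo j ⟩
    j                             ∎
    where
    undo : ∀ l → rotate (s * m) (rotate s l) ≡ l
    undo l = begin
      rotate (s * m) (rotate s l) ≡⟨ rotate-rotate s (s * m) l ⟩
      rotate (s + s * m) l        ≡⟨ cong (λ r → rotate r l) (*-suc s m) ⟨
      rotate (s * K) l            ≡⟨ rotate-multiple s l ⟩
      l                           ∎

  next≡rotate1 : ∀ (j : Fin K) → next j ≡ rotate 1 j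
  next≡rotate1 j = cong (_mod K) (+-comm 1 (toℕ j))

  rotate-next : ∀ s (j : Fin K) → rotate s (next j) ≡ next (rotate s j)
  rotate-next s j = begin
    rotate s (next j)      ≡⟨ cong (rotate s) (next≡rotate1 j) ⟩
    rotate s (rotate 1 j)  ≡⟨ rotate-rotate 1 s j ⟩
    rotate (1 + s) j       ≡⟨ cong (λ r → rotate r j) (+-comm 1 s) ⟩
    rotate (s + 1) j       ≡⟨ rotate-rotate s 1 j ⟨
    rotate 1 (rotate s j)  ≡⟨ next≡rotate1 (rotate s j) ⟨
    next (rotate s j)      ∎

  rotate-fromℕ : ∀ (i : Fin K) → rotate (suc (toℕ i)) (fromℕ m) ≡ i
  rotate-fromℕ i = toℕ-injective (begin
    toℕ (rotate (suc (toℕ i)) (fromℕ m)) ≡⟨ toℕ-rotate (suc (toℕ i)) (fromℕ m) ⟩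
    (toℕ (fromℕ m) + suc (toℕ i)) % K    ≡⟨ cong (λ r → (r + suc (toℕ i)) % K) (toℕ-fromℕ m) ⟩
    (m + suc (toℕ i)) % K                ≡⟨ cong (_% K) (trans (+-suc m (toℕ i)) (+-comm K (toℕ i))) ⟩
    (toℕ i + K) % K                      ≡⟨ [m+n]%n≡m%n (toℕ i) K ⟩
    toℕ i % K                            ≡⟨ m<n⇒m%n≡m (toℕ<n i) ⟩
    toℕ i                                ∎)

module _ {n} {G : Multigraph2 n} {m} (C : Cycle G (suc m)) where

  rotateCycle : ℕ → Cycle G (suc m)
  rotateCycle s = record
    { two≤k    = two≤k C
    ; vtx      = vtx C ∘ rotate s
    ; distinct = rotate-injective s ∘ distinct C
    ; col      = col C ∘ rotate s
    ; edge     = λ j → subst (λ l → E G (vtx C (rotate s j)) (vtx C l) (col C (rotate s j)) ≡ true)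
                             (sym (rotate-next s j)) (edge C (rotate s j))
    }

  rotateCycle-proper : ∀ s → Proper C → Proper (rotateCycle s)
  rotateCycle-proper s proper j eq = proper (rotate s j) (trans eq (cong (col C) (rotate-next s j)))

  OnCycle-rotateCycle : ∀ s {x} → OnCycle (rotateCycle s) x → OnCycle C x
  OnCycle-rotateCycle s (j , eq) = rotate s j , eq

ProperCycleThrough : ∀ {n} → Multigraph2 n → ℕ → Fin n → Fin n → Set
ProperCycleThrough G k a b = Σ (Cycle G k) (λ D → Proper D × UsesEdge D a b red)

UsesEdge-swap : ∀ {n} {G : Multigraph2 n} {k} {D : Cycle G k} {a b c} →
  UsesEdge D a b c → UsesEdge D b a c
UsesEdge-swap (i , colour , inj₁ ends) = i , colour , inj₂ ends
UsesEdge-swap (i , colour , inj₂ ends) = i , colour , inj₁ ends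

ProperCycleThrough-swap : ∀ {n} {G : Multigraph2 n} {k a b} →
  ProperCycleThrough G k a b → ProperCycleThrough G k b a
ProperCycleThrough-swap (D , proper , uses) = D , proper , UsesEdge-swap {D = D} uses

next-suc-suc : ∀ {m} (u : Fin (suc m)) →
  (u ≡ fromℕ m × next (suc (suc u)) ≡ zero) ⊎ next (suc (suc u)) ≡ suc (suc (next u))
next-suc-suc {m} u with fromℕ-or-inject₁ u
... | inj₁ refl      = inj₁ (refl , next-fromℕ (suc (suc m)))
... | inj₂ (v , refl) =
  inj₂ (trans (next-inject₁ (suc (suc v))) (cong (λ l → suc (suc l)) (sym (next-inject₁ v))))

module AppendPair {n} {G : Multigraph2 n} {m} (C : Cycle G (suc m)) (proper : Proper C)
  (last-blue : col C (fromℕ m) ≡ blue) {a b : Fin n} (a∉C : ¬ OnCycle C a) (b∉C : ¬ OnCycle C b)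
  (ab-red : E G a b red ≡ true) (last-a : E G (vtx C (fromℕ m)) a blue ≡ true)
  (b-first : E G b (vtx C zero) blue ≡ true) where

  vtx′ : Fin (2 + suc m) → Fin n
  vtx′ zero          = a
  vtx′ (suc zero)    = b
  vtx′ (suc (suc u)) = vtx C u

  col′ : Fin (2 + suc m) → Color
  col′ zero          = red
  col′ (suc zero)    = blue
  col′ (suc (suc u)) = col C u

  edge′ : ∀ j → E G (vtx′ j) (vtx′ (next j)) (col′ j) ≡ true
  edge′ zero       = ab-red
  edge′ (suc zero) = b-first
  edge′ (suc (suc u)) with next-suc-suc u
  ... | inj₁ (refl , eq) rewrite eq | last-blue = last-a
  ... | inj₂ eq          rewrite eq = edge C u

  proper′ : ∀ j → ¬ col′ j ≡ col′ (next j)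
  proper′ zero ()
  proper′ (suc zero) eq =
    proper (fromℕ m) (trans last-blue (trans eq (cong (col C) (sym (next-fromℕ m)))))
  proper′ (suc (suc u)) with next-suc-suc u
  ... | inj₁ (refl , eq) rewrite eq | last-blue = λ ()
  ... | inj₂ eq          rewrite eq = proper u

  a≢b : ¬ a ≡ b
  a≢b refl with trans (sym ab-red) (loopless G a red)
  ... | ()

  distinct′ : ∀ {i j} → vtx′ i ≡ vtx′ j → i ≡ j
  distinct′ {zero}        {zero}        eq = refl
  distinct′ {zero}        {suc zero}    eq = ⊥-elim (a≢b eq)
  distinct′ {zero}        {suc (suc v)} eq = ⊥-elim (a∉C (v , sym eq))
  distinct′ {suc zero}    {zero}        eq = ⊥-elim (a≢b (sym eq))
  distinct′ {suc zero}    {suc zero}    eq = refl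
  distinct′ {suc zero}    {suc (suc v)} eq = ⊥-elim (b∉C (v , sym eq))
  distinct′ {suc (suc u)} {zero}        eq = ⊥-elim (a∉C (u , eq))
  distinct′ {suc (suc u)} {suc zero}    eq = ⊥-elim (b∉C (u , eq))
  distinct′ {suc (suc u)} {suc (suc v)} eq = cong (λ l → suc (suc l)) (distinct C eq)

  appended : ProperCycleThrough G (2 + suc m) a b
  appended = cycle , proper′ , (zero , refl , inj₁ (refl , refl))
    where
    cycle : Cycle G (2 + suc m)
    cycle = record
      { two≤k = s≤s (s≤s z≤n) ; vtx = vtx′ ; distinct = distinct′ ; col = col′ ; edge = edge′ }

-- The blue edge v_i v_{i+1} of C can be replaced by the path v_i a b v_{i+1}.
Insertable : ∀ {n} {G : Multigraph2 n} {k} → Cycle G k → Fin n → Fin n → Fin k → Set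
Insertable {G = G} C a b i =
  col C i ≡ blue × E G a (vtx C i) blue ≡ true × E G b (vtx C (next i)) blue ≡ true

_≟ᶜ_ : (c d : Color) → Dec (c ≡ d)
red  ≟ᶜ red  = yes refl
red  ≟ᶜ blue = no λ ()
blue ≟ᶜ red  = no λ ()
blue ≟ᶜ blue = yes refl

insertable? : ∀ {n} {G : Multigraph2 n} {k} (C : Cycle G k) a b i → Dec (Insertable C a b i)
insertable? {G = G} C a b i =
  (col C i ≟ᶜ blue) ×-dec (E G a (vtx C i) blue Bool.≟ true)
                    ×-dec (E G b (vtx C (next i)) blue Bool.≟ true)

insert : ∀ {n} {G : Multigraph2 n} {m} (C : Cycle G (suc m)) → Proper C → ∀ {a b} →
  ¬ OnCycle C a → ¬ OnCycle C b → E G a b red ≡ true →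
  ∀ i → Insertable C a b i → ProperCycleThrough G (suc m + 2) a b
insert {G = G} {m} C proper {a} {b} a∉C b∉C ab-red i (i-blue , a-vᵢ , b-vᵢ₊₁) =
  subst (λ k → ProperCycleThrough G k a b) (+-comm 2 (suc m))
        (AppendPair.appended C′ proper′ last-blue a∉C′ b∉C′ ab-red last-a b-vᵢ₊₁)
  where
  -- C′ starts at v_{i+1}, so that v_i is its last vertex.
  C′ : Cycle G (suc m)
  C′ = rotateCycle C (suc (toℕ i))
  proper′ : Proper C′
  proper′ = rotateCycle-proper C (suc (toℕ i)) proper
  a∉C′ : ¬ OnCycle C′ a
  a∉C′ = a∉C ∘ OnCycle-rotateCycle C (suc (toℕ i))
  b∉C′ : ¬ OnCycle C′ b
  b∉C′ = b∉C ∘ OnCycle-rotateCycle C (suc (toℕ i))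
  last-blue : col C′ (fromℕ m) ≡ blue
  last-blue = trans (cong (col C) (rotate-fromℕ i)) i-blue
  last-a : E G (vtx C′ (fromℕ m)) a blue ≡ true
  last-a = trans (cong (λ j → E G (vtx C j) a blue) (rotate-fromℕ i)) (trans (E-sym G _ a blue) a-vᵢ)

𝟙 : Bool → ℕ
𝟙 p = if p then 1 else 0

countFin≡sum : ∀ k (p : Fin k → Bool) → countFin k p ≡ sum (𝟙 ∘ p)
countFin≡sum zero    p = refl
countFin≡sum (suc k) p = cong (𝟙 (p zero) +_) (countFin≡sum k (p ∘ suc))

𝟙+𝟙≤1 : ∀ {p q} → ¬ (p ≡ true × q ≡ true) → 𝟙 p + 𝟙 q ≤ 1
𝟙+𝟙≤1 {true}  {true}  ¬both = ⊥-elim (¬both (refl , refl))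
𝟙+𝟙≤1 {true}  {false} ¬both = ≤-refl
𝟙+𝟙≤1 {false} {true}  ¬both = ≤-refl
𝟙+𝟙≤1 {false} {false} ¬both = z≤n

sum-mono-≤ : ∀ {k} {f g : Fin k → ℕ} → (∀ i → f i ≤ g i) → sum f ≤ sum g
sum-mono-≤ {zero}  f≤g = z≤n
sum-mono-≤ {suc k} f≤g = +-mono-≤ (f≤g zero) (sum-mono-≤ (f≤g ∘ suc))

sum-const-1 : ∀ k → sum {k} (λ _ → 1) ≡ k
sum-const-1 zero    = refl
sum-const-1 (suc k) = cong suc (sum-const-1 k)

sum-next : ∀ {m} (f : Fin (suc m) → ℕ) → sum (f ∘ next) ≡ sum f
sum-next {m} f = begin
  sum (f ∘ next)                                   ≡⟨ sum-init-last (f ∘ next) ⟩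
  sum (f ∘ next ∘ inject₁) + f (next (fromℕ m))
    ≡⟨ cong₂ _+_ (sum-cong-≗ (cong f ∘ next-inject₁)) (cong f (next-fromℕ m)) ⟩
  sum (f ∘ suc) + f zero                           ≡⟨ +-comm (sum (f ∘ suc)) (f zero) ⟩
  sum f                                            ∎

isBlue isRed : Color → ℕ
isBlue blue = 1
isBlue red  = 0
isRed  blue = 0
isRed  red  = 1

isBlue*v+isRed*v≡v : ∀ c v → isBlue c * v + isRed c * v ≡ v
isBlue*v+isRed*v≡v blue v = trans (+-identityʳ (1 * v)) (*-identityˡ v)
isBlue*v+isRed*v≡v red  v = *-identityˡ v

isRed≡isBlue : ∀ {c d} → ¬ c ≡ d → isRed d ≡ isBlue c
isRed≡isBlue {blue} {blue} c≢d = ⊥-elim (c≢d refl)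
isRed≡isBlue {blue} {red}  c≢d = refl
isRed≡isBlue {red}  {blue} c≢d = refl
isRed≡isBlue {red}  {red}  c≢d = ⊥-elim (c≢d refl)

-- In an alternating cyclic colouring every position is an end of exactly one blue edge.
sum-over-blue-edges : ∀ {m} (c : Fin (suc m) → Color) → (∀ j → ¬ c j ≡ c (next j)) →
  ∀ f → sum f ≡ sum (λ j → isBlue (c j) * (f j + f (next j)))
sum-over-blue-edges c alt f = begin
  sum f
    ≡⟨ sum-cong-≗ (λ j → sym (isBlue*v+isRed*v≡v (c j) (f j))) ⟩
  sum (λ j → isBlue (c j) * f j + isRed (c j) * f j)
    ≡⟨ ∑-distrib-+ (λ j → isBlue (c j) * f j) (λ j → isRed (c j) * f j) ⟩
  sum (λ j → isBlue (c j) * f j) + sum (λ j → isRed (c j) * f j)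
    ≡⟨ cong (sum (λ j → isBlue (c j) * f j) +_) (sum-next (λ j → isRed (c j) * f j)) ⟨
  sum (λ j → isBlue (c j) * f j) + sum (λ j → isRed (c (next j)) * f (next j))
    ≡⟨ cong (sum (λ j → isBlue (c j) * f j) +_) (sum-cong-≗ (λ j → cong (_* f (next j)) (isRed≡isBlue (alt j)))) ⟩
  sum (λ j → isBlue (c j) * f j) + sum (λ j → isBlue (c j) * f (next j))
    ≡⟨ ∑-distrib-+ (λ j → isBlue (c j) * f j) (λ j → isBlue (c j) * f (next j)) ⟨
  sum (λ j → isBlue (c j) * f j + isBlue (c j) * f (next j))
    ≡⟨ sum-cong-≗ (λ j → sym (*-distribˡ-+ (isBlue (c j)) (f j) (f (next j)))) ⟩
  sum (λ j → isBlue (c j) * (f j + f (next j)))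
    ∎

sum≤length : ∀ {m} (c : Fin (suc m) → Color) → (∀ j → ¬ c j ≡ c (next j)) →
  ∀ f → (∀ j → c j ≡ blue → f j + f (next j) ≤ 2) → sum f ≤ suc m
sum≤length {m} c alt f blue≤2 =
  subst₂ _≤_ (sym (sum-over-blue-edges c alt f))
             (trans (sym (sum-over-blue-edges c alt (λ _ → 1))) (sum-const-1 (suc m)))
             (sum-mono-≤ weighted≤)
  where
  weighted≤ : ∀ j → isBlue (c j) * (f j + f (next j)) ≤ isBlue (c j) * 2
  weighted≤ j with c j in cj
  ... | blue = *-monoʳ-≤ 1 (blue≤2 j cj)
  ... | red  = z≤n

degree-sum≤length : ∀ {n} {G : Multigraph2 n} {m} (C : Cycle G (suc m)) → Proper C → ∀ x y →
  (∀ i → ¬ Insertable C x y i) → (∀ i → ¬ Insertable C y x i) →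
  degC blue C x + degC blue C y ≤ suc m
degree-sum≤length {G = G} {m} C proper x y ¬xy ¬yx =
  subst (_≤ suc m) degrees≡sum (sum≤length (col C) proper f blue≤2)
  where
  xᵢ yᵢ : Fin (suc m) → Bool
  xᵢ i = E G x (vtx C i) blue
  yᵢ i = E G y (vtx C i) blue
  f : Fin (suc m) → ℕ
  f i = 𝟙 (xᵢ i) + 𝟙 (yᵢ i)
  degrees≡sum : sum f ≡ degC blue C x + degC blue C y
  degrees≡sum = trans (∑-distrib-+ (𝟙 ∘ xᵢ) (𝟙 ∘ yᵢ))
                      (sym (cong₂ _+_ (countFin≡sum (suc m) xᵢ) (countFin≡sum (suc m) yᵢ)))
  blue≤2 : ∀ i → col C i ≡ blue → f i + f (next i) ≤ 2
  blue≤2 i i-blue = subst (_≤ 2) (regroup (𝟙 (xᵢ i)) (𝟙 (yᵢ i)) (𝟙 (xᵢ (next i))) (𝟙 (yᵢ (next i))))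
    (+-mono-≤ (𝟙+𝟙≤1 λ (p , q) → ¬xy i (i-blue , p , q)) (𝟙+𝟙≤1 λ (p , q) → ¬yx i (i-blue , p , q)))
    where
    regroup : ∀ p q r s → (p + s) + (q + r) ≡ (p + q) + (r + s)
    regroup = solve-∀

insertable-exists : ∀ {n} {G : Multigraph2 n} {m} (C : Cycle G (suc m)) → Proper C → ∀ x y →
  suc m < degC blue C x + degC blue C y →
  ∃ λ i → Insertable C x y i ⊎ Insertable C y x i
insertable-exists C proper x y many with any? (λ i → insertable? C x y i ⊎-dec insertable? C y x i)
... | yes found = found
... | no none   = ⊥-elim (<⇒≱ many (degree-sum≤length C proper x y
                                       (λ i → none ∘ (i ,_) ∘ inj₁) (λ i → none ∘ (i ,_) ∘ inj₂)))

lemma2 : ∀ {n} (G : Multigraph2 n) → Connected G →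
    ∀ {k} (C : Cycle G k) → Proper C → k ≤ n ∸ 2 →
    ∀ (x y : Fin n) → E G x y red ≡ true →
    ¬ OnCycle C x → ¬ OnCycle C y →
    k < degC blue C x + degC blue C y →
    Σ (Cycle G (k + 2)) (λ D → Proper D × UsesEdge D x y red)
lemma2 G _ {zero} C _ _ _ _ _ _ _ _ with two≤k C
... | ()
lemma2 G _ {suc m} C proper _ x y xy-red x∉C y∉C many with insertable-exists C proper x y many
... | i , inj₁ xy-at-i = insert C proper x∉C y∉C xy-red i xy-at-i
... | i , inj₂ yx-at-i =
  ProperCycleThrough-swap (insert C proper y∉C x∉C (trans (E-sym G y x red) xy-red) i yx-at-i)
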